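{- Let $P$ be an odd prime and let $A\le B\le C$ be positive integers with $\frac4P=\frac1A+\frac1B+\frac1C$. If exactly two of $A,B,C$ are divisible by $P$, then they are $B$ and $C$, i.e.\ $B=bP$, $C=cP$ and $P\nmid A$. In other words, the configurations ($P\mid A$, $P\mid B$, $P\nmid C$) and ($P\mid A$, $P\mid C$, $P\nmid B$) are impossible. -}

module Defs where

open import Data.Nat using (ℕ; _*_; _+_)
open import Data.Nat.Divisibility using (_∣_)
open import Data.Product using (_×_)
open import Data.Sum using (_⊎_)
open import Relation.Nullary using (¬_)
open import Relation.Binary.PropositionalEquality using (_≡_)

-- 4/P = 1/A + 1/B + 1/C, with denominators cleared (all of P, A, B, C positive):
-- 4·A·B·C = P·(B·C + A·C + A·B)
ErdosStraus : ℕ → ℕ → ℕ → ℕ → Set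
ErdosStraus P A B C = 4 * A * B * C ≡ P * (B * C + A * C + A * B)

ExactlyTwoDivisible : ℕ → ℕ → ℕ → ℕ → Set
ExactlyTwoDivisible P A B C =
    (P ∣ A × P ∣ B × ¬ (P ∣ C))
  ⊎ (P ∣ A × ¬ (P ∣ B) × P ∣ C)
  ⊎ (¬ (P ∣ A) × P ∣ B × P ∣ C)

{-# OPTIONS --safe #-}
module Submission where

-- If P divides two denominators, xP and yP, then cancelling P² from the equation leaves
-- 4xyZ = (x + y)Z + xyP for the third denominator Z.  When xP ≤ Z the last term is at most
-- yZ, so 4xy ≤ x + 2y, which fails for all positive x, y.  In both forbidden configurations
-- the ordering A ≤ B ≤ C supplies the bound xP ≤ Z (with Z = C, resp. Z = B).

open import Defs
open import Data.Nat.Base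
open import Data.Nat.Properties
open import Data.Nat.Divisibility using (_∣_; divides)
open import Data.Nat.Primality using (Prime)
open import Data.Nat.Tactic.RingSolver using (solve)
open import Data.List.Base using ([]; _∷_)
open import Data.Product.Base using (_×_; _,_)
open import Data.Sum.Base using (inj₁; inj₂)
open import Data.Empty using (⊥-elim)
open import Relation.Nullary using (¬_)
open import Relation.Binary.PropositionalEquality

x+2y<4xy : ∀ x y .{{_ : NonZero x}} .{{_ : NonZero y}} → x + 2 * y < 4 * x * y
x+2y<4xy (suc m) (suc n) = begin-strict
  suc m + 2 * suc n
    <⟨ m≤m+n _ _ ⟩
  suc (suc m + 2 * suc n) + (4 * m * n + 3 * m + 2 * n)
    ≡⟨ solve (m ∷ n ∷ []) ⟩
  4 * suc m * suc n ∎
  where open ≤-Reasoning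

reduced-equation-unsolvable : ∀ {x y Z P} .{{_ : NonZero x}} .{{_ : NonZero y}} .{{_ : NonZero Z}} →
  x * P ≤ Z → 4 * x * y * Z ≢ (x + y) * Z + x * y * P
reduced-equation-unsolvable {x} {y} {Z} {P} xP≤Z eq =
  <⇒≱ (x+2y<4xy x y) (*-cancelʳ-≤ (4 * x * y) (x + 2 * y) Z 4xyZ≤[x+2y]Z)
  where
  open ≤-Reasoning
  4xyZ≤[x+2y]Z : 4 * x * y * Z ≤ (x + 2 * y) * Z
  4xyZ≤[x+2y]Z = begin
    4 * x * y * Z              ≡⟨ eq ⟩
    (x + y) * Z + x * y * P    ≡⟨ cong ((x + y) * Z +_) (solve (x ∷ y ∷ P ∷ [])) ⟩
    (x + y) * Z + y * (x * P)  ≤⟨ +-monoʳ-≤ ((x + y) * Z) (*-monoʳ-≤ y xP≤Z) ⟩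
    (x + y) * Z + y * Z        ≡⟨ solve (x ∷ y ∷ Z ∷ []) ⟩
    (x + 2 * y) * Z            ∎

ErdosStraus-cancel-P² : ∀ {P x y Z} .{{_ : NonZero P}} → ErdosStraus P (x * P) (y * P) Z →
  4 * x * y * Z ≡ (x + y) * Z + x * y * P
ErdosStraus-cancel-P² {P} {x} {y} {Z} es =
  *-cancelˡ-≡ (4 * x * y * Z) ((x + y) * Z + x * y * P) (P * P) {{m*n≢0 P P}} (begin
    P * P * (4 * x * y * Z)                                   ≡⟨ solve (P ∷ x ∷ y ∷ Z ∷ []) ⟩
    4 * (x * P) * (y * P) * Z                                 ≡⟨ es ⟩
    P * ((y * P) * Z + (x * P) * Z + (x * P) * (y * P))       ≡⟨ solve (P ∷ x ∷ y ∷ Z ∷ []) ⟩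
    P * P * ((x + y) * Z + x * y * P)                         ∎)
  where open ≡-Reasoning

ErdosStraus-two-multiples : ∀ {P A B Z} → 0 < A → 0 < B → A ≤ Z → P ∣ A → P ∣ B →
  ¬ ErdosStraus P A B Z
ErdosStraus-two-multiples {P} {Z = Z} 0<xP 0<yP xP≤Z (divides x refl) (divides y refl) es =
  reduced-equation-unsolvable {x} {y} {Z} {P} xP≤Z (ErdosStraus-cancel-P² {P} {x} {y} {Z} es)
  where
  instance
    _ : NonZero P
    _ = m*n≢0⇒n≢0 x {{>-nonZero 0<xP}}
    _ : NonZero x
    _ = m*n≢0⇒m≢0 x {{>-nonZero 0<xP}}
    _ : NonZero y
    _ = m*n≢0⇒m≢0 y {{>-nonZero 0<yP}}
    _ : NonZero Z
    _ = >-nonZero (<-≤-trans 0<xP xP≤Z)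

ErdosStraus-swap₁₂ : ∀ {P A B C} → ErdosStraus P A B C → ErdosStraus P B A C
ErdosStraus-swap₁₂ {P} {A} {B} {C} es = begin
  4 * B * A * C                   ≡⟨ solve (A ∷ B ∷ C ∷ []) ⟩
  4 * A * B * C                   ≡⟨ es ⟩
  P * (B * C + A * C + A * B)     ≡⟨ solve (P ∷ A ∷ B ∷ C ∷ []) ⟩
  P * (A * C + B * C + B * A)     ∎
  where open ≡-Reasoning

ErdosStraus-swap₂₃ : ∀ {P A B C} → ErdosStraus P A B C → ErdosStraus P A C B
ErdosStraus-swap₂₃ {P} {A} {B} {C} es = begin
  4 * A * C * B                   ≡⟨ solve (A ∷ B ∷ C ∷ []) ⟩
  4 * A * B * C                   ≡⟨ es ⟩
  P * (B * C + A * C + A * B)     ≡⟨ solve (P ∷ A ∷ B ∷ C ∷ []) ⟩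
  P * (C * B + A * B + A * C)     ∎
  where open ≡-Reasoning

lemma8p5 : (P A B C : ℕ) → Prime P → ¬ (2 ∣ P) → 0 < A → A ≤ B → B ≤ C →
    ErdosStraus P A B C → ExactlyTwoDivisible P A B C →
    (P ∣ B × P ∣ C × ¬ (P ∣ A))
lemma8p5 P A B C _ _ 0<A A≤B B≤C es (inj₁ (P∣A , P∣B , _)) =
  ⊥-elim (ErdosStraus-two-multiples 0<B 0<A B≤C P∣B P∣A (ErdosStraus-swap₁₂ {P} {A} {B} {C} es))
  where 0<B = <-≤-trans 0<A A≤B
lemma8p5 P A B C _ _ 0<A A≤B B≤C es (inj₂ (inj₁ (P∣A , _ , P∣C))) =
  ⊥-elim (ErdosStraus-two-multiples 0<A 0<C A≤B P∣A P∣C (ErdosStraus-swap₂₃ {P} {A} {B} {C} es))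
  where 0<C = <-≤-trans 0<A (≤-trans A≤B B≤C)
lemma8p5 P A B C _ _ _ _ _ _ (inj₂ (inj₂ (P∤A , P∣B , P∣C))) = P∣B , P∣C , P∤A
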